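{- Let $U=(X,B)$ be an abstract unital of order $n\ge 2$ and let $b_1,b_2\in B$ be distinct blocks. Then $|F_U(b_1,b_2)|\le n^2-n$ if $b_1$ and $b_2$ have a point in common, and $|F_U(b_1,b_2)|\le n^2-1$ if $b_1$ and $b_2$ are disjoint.
   Context: An abstract unital of order $n$ is a $2$-$(n^3+1,n+1,1)$ design $(X,B)$. For blocks $b_1,b_2$, a point $P\in X$ is a full point with respect to $(b_1,b_2)$ if $P\notin b_1\cup b_2$ and for every $Q\in b_1$ the block through $P$ and $Q$ intersects $b_2$. $F_U(b_1,b_2)$ denotes the set of all such full points. -}

module Defs where

open import Data.Nat using (ℕ; suc; _+_; _*_; _^_)
open import Data.Fin using (Fin)
open import Data.Fin.Subset using (Subset; _∈_; _∉_; ∣_∣)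
open import Data.Product using (Σ; ∃; _×_; _,_)
open import Relation.Binary.PropositionalEquality using (_≡_; _≢_)

record AbstractUnital (n : ℕ) : Set where
  field
    m      : ℕ
    block  : Fin m → Subset (suc (n ^ 3))
    blockSize : ∀ b → ∣ block b ∣ ≡ n + 1
    join      : ∀ (P Q : Fin (suc (n ^ 3))) → P ≢ Q →
                ∃ λ b → P ∈ block b × Q ∈ block b
    joinUnique : ∀ (P Q : Fin (suc (n ^ 3))) → P ≢ Q → ∀ b c →
                 P ∈ block b → Q ∈ block b → P ∈ block c → Q ∈ block c → b ≡ c

module _ {n : ℕ} (U : AbstractUnital n) where
  open AbstractUnital U

  Point : Set
  Point = Fin (suc (n ^ 3))

  Meet : Fin m → Fin m → Set
  Meet b c = ∃ λ (R : Point) → R ∈ block b × R ∈ block c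

  IsFull : Fin m → Fin m → Point → Set
  IsFull b₁ b₂ P =
    P ∉ block b₁ × P ∉ block b₂ ×
    (∀ Q → Q ∈ block b₁ → ∀ c → P ∈ block c → Q ∈ block c → Meet c b₂)

  -- S is contained in F_U(b₁ , b₂)
  FullSet : Fin m → Fin m → Subset (suc (n ^ 3)) → Set
  FullSet b₁ b₂ S = ∀ P → P ∈ S → IsFull b₁ b₂ P

-- Fix a point Q ∈ b₁ ∖ b₂. A full point P lies on the block through P and Q,
-- which meets b₂ in some point T, so P lies on the block QT but is neither
-- Q nor T: there are at most n − 1 choices of P for each T ∈ b₂. This gives
-- (n + 1)(n − 1) = n² − 1 when b₁, b₂ are disjoint. When they meet in R, pick
-- Q ≠ R; the block QR is b₁ itself, which contains no full point, so T ranges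
-- over the n points of b₂ − R only, giving n(n − 1) = n² − n.
module Submission where

open import Defs
open import Data.Nat using (ℕ; zero; suc; _+_; _≤_; _*_; _∸_; _^_; z≤n; s≤s)
open import Data.Nat.Properties
  using (≤-trans; ≤-reflexive; ≤-pred; +-suc; +-mono-≤; +-monoʳ-≤; n≤1+n; m≤m+n; +-comm;
         *-monoˡ-≤; n≮n; ∸-monoˡ-≤; m+n∸n≡m; module ≤-Reasoning; *-identityʳ; *-distribˡ-∸)
open import Data.Nat.Tactic.RingSolver using (solve-∀)
open import Data.Fin using (Fin; zero; suc; _≟_)
open import Data.Fin.Properties using (any?)
open import Data.Fin.Subset
  using (Subset; inside; outside; _∈_; _∉_; _⊆_; _∪_; _-_; ⊥; ⁅_⁆; ∣_∣)
open import Data.Fin.Subset.Properties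
  using (x∈p∪q⁺; ∣⊥∣≡0; p⊆q⇒∣p∣≤∣q∣; x∈p∧x≢y⇒x∈p-y; x∈p⇒∣p-x∣<∣p∣; p─q⊆p;
         _∈?_; x∈⁅x⁆; ⊆-refl; ∣⁅x⁆∣≡1)
open import Data.Vec using (_∷_; [])
open import Data.Vec.Base using (here; there)
open import Data.Product using (_×_; _,_; proj₁; proj₂; ∃-syntax)
open import Data.Sum using (inj₁; inj₂)
open import Relation.Nullary using (¬_; yes; no; ¬?; _×-dec_; contradiction)
open import Function using (_∘_)
open import Relation.Binary.PropositionalEquality
  using (_≡_; _≢_; refl; sym; trans; cong; cong₂; subst; module ≡-Reasoning)

private
  variable
    N M k : ℕ

∣p∪q∣≤∣p∣+∣q∣ : (p q : Subset N) → ∣ p ∪ q ∣ ≤ ∣ p ∣ + ∣ q ∣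
∣p∪q∣≤∣p∣+∣q∣ []            []            = z≤n
∣p∪q∣≤∣p∣+∣q∣ (outside ∷ p) (outside ∷ q) = ∣p∪q∣≤∣p∣+∣q∣ p q
∣p∪q∣≤∣p∣+∣q∣ (outside ∷ p) (inside  ∷ q) =
  ≤-trans (s≤s (∣p∪q∣≤∣p∣+∣q∣ p q)) (≤-reflexive (sym (+-suc ∣ p ∣ ∣ q ∣)))
∣p∪q∣≤∣p∣+∣q∣ (inside  ∷ p) (outside ∷ q) = s≤s (∣p∪q∣≤∣p∣+∣q∣ p q)
∣p∪q∣≤∣p∣+∣q∣ (inside  ∷ p) (inside  ∷ q) =
  s≤s (≤-trans (∣p∪q∣≤∣p∣+∣q∣ p q) (+-monoʳ-≤ ∣ p ∣ (n≤1+n ∣ q ∣)))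

⋃[_]_ : Subset N → (Fin N → Subset M) → Subset M
⋃[ []          ] F = ⊥
⋃[ outside ∷ p ] F = ⋃[ p ] (λ i → F (suc i))
⋃[ inside  ∷ p ] F = F zero ∪ ⋃[ p ] (λ i → F (suc i))

x∈⋃⁺ : ∀ (p : Subset N) (F : Fin N → Subset M) {i x} → i ∈ p → x ∈ F i → x ∈ ⋃[ p ] F
x∈⋃⁺ (inside  ∷ p) F here        x∈Fi = x∈p∪q⁺ (inj₁ x∈Fi)
x∈⋃⁺ (outside ∷ p) F (there i∈p) x∈Fi = x∈⋃⁺ p (λ i → F (suc i)) i∈p x∈Fi
x∈⋃⁺ (inside  ∷ p) F (there i∈p) x∈Fi =
  x∈p∪q⁺ {p = F zero} (inj₂ (x∈⋃⁺ p (λ i → F (suc i)) i∈p x∈Fi))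

∣⋃∣≤∣p∣*k : ∀ (p : Subset N) (F : Fin N → Subset M) →
            (∀ {i} → i ∈ p → ∣ F i ∣ ≤ k) → ∣ ⋃[ p ] F ∣ ≤ ∣ p ∣ * k
∣⋃∣≤∣p∣*k {M = M} []            F bound = ≤-reflexive (∣⊥∣≡0 M)
∣⋃∣≤∣p∣*k         (outside ∷ p) F bound =
  ∣⋃∣≤∣p∣*k p (λ i → F (suc i)) (λ i∈p → bound (there i∈p))
∣⋃∣≤∣p∣*k         (inside  ∷ p) F bound =
  ≤-trans (∣p∪q∣≤∣p∣+∣q∣ (F zero) _)
          (+-mono-≤ (bound here) (∣⋃∣≤∣p∣*k p (λ i → F (suc i)) (λ i∈p → bound (there i∈p))))

2≤∣p∣⇒∃x∈p∧x≢y : (p : Subset N) (y : Fin N) → 2 ≤ ∣ p ∣ → ∃[ x ] x ∈ p × x ≢ y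
2≤∣p∣⇒∃x∈p∧x≢y p y 2≤∣p∣ with any? (λ x → (x ∈? p) ×-dec ¬? (x ≟ y))
... | yes witness = witness
... | no  none    =
  contradiction (≤-trans 2≤∣p∣ (≤-trans (p⊆q⇒∣p∣≤∣q∣ p⊆⁅y⁆) (≤-reflexive (∣⁅x⁆∣≡1 y)))) (n≮n 1)
  where
  p⊆⁅y⁆ : p ⊆ ⁅ y ⁆
  p⊆⁅y⁆ {x} x∈p with x ≟ y
  ... | yes refl = x∈⁅x⁆ x
  ... | no  x≢y  = contradiction (x , x∈p , x≢y) none

∣p-x-y∣≤∣p∣∸2 : ∀ {p : Subset N} {x y} → x ∈ p → y ∈ p → x ≢ y → ∣ p - x - y ∣ ≤ ∣ p ∣ ∸ 2
∣p-x-y∣≤∣p∣∸2 x∈p y∈p x≢y =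
  ∸-monoˡ-≤ 2 (≤-trans (s≤s (x∈p⇒∣p-x∣<∣p∣ (x∈p∧x≢y⇒x∈p-y y∈p (x≢y ∘ sym)))) (x∈p⇒∣p-x∣<∣p∣ x∈p))

n*[n∸1]≡n^2∸n : ∀ n → n * (n ∸ 1) ≡ n ^ 2 ∸ n
n*[n∸1]≡n^2∸n n = begin
  n * (n ∸ 1)     ≡⟨ *-distribˡ-∸ n n 1 ⟩
  n * n ∸ n * 1   ≡⟨ cong₂ _∸_ (cong (n *_) (sym (*-identityʳ n))) (*-identityʳ n) ⟩
  n * (n * 1) ∸ n ∎
  where open ≡-Reasoning

[n+1]*[n∸1]≡n^2∸1 : ∀ n → (n + 1) * (n ∸ 1) ≡ n ^ 2 ∸ 1
[n+1]*[n∸1]≡n^2∸1 zero    = refl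
[n+1]*[n∸1]≡n^2∸1 (suc k) = begin
  (suc k + 1) * k         ≡⟨ sym (m+n∸n≡m _ 1) ⟩
  (suc k + 1) * k + 1 ∸ 1 ≡⟨ cong (_∸ 1) (square k) ⟩
  suc k ^ 2 ∸ 1           ∎
  where
  open ≡-Reasoning
  square : ∀ k → (1 + k + 1) * k + 1 ≡ (1 + k) * ((1 + k) * 1)
  square = solve-∀

module _ {n : ℕ} (U : AbstractUnital n) where
  open AbstractUnital U

  ∣block-x-y∣≤n∸1 : ∀ {c x y} → x ∈ block c → y ∈ block c → x ≢ y → ∣ block c - x - y ∣ ≤ n ∸ 1
  ∣block-x-y∣≤n∸1 {c} x∈c y∈c x≢y = begin
    ∣ block c - _ - _ ∣ ≤⟨ ∣p-x-y∣≤∣p∣∸2 x∈c y∈c x≢y ⟩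
    ∣ block c ∣ ∸ 2     ≡⟨ cong (_∸ 2) (trans (blockSize c) (+-comm n 1)) ⟩
    n ∸ 1               ∎
    where open ≤-Reasoning

  -- The block through x and y, with the junk value b when x ≡ y.
  joinOr : Fin m → Point U → Point U → Fin m
  joinOr b x y with x ≟ y
  ... | yes _   = b
  ... | no  x≢y = proj₁ (join x y x≢y)

  joinOr-∈ : ∀ b {x y} → x ≢ y → x ∈ block (joinOr b x y) × y ∈ block (joinOr b x y)
  joinOr-∈ b {x} {y} x≢y with x ≟ y
  ... | yes x≡y  = contradiction x≡y x≢y
  ... | no  x≢y′ = proj₂ (join x y x≢y′)

  joinOr-unique : ∀ b {c x y} → x ≢ y → x ∈ block c → y ∈ block c → joinOr b x y ≡ c
  joinOr-unique b x≢y = joinUnique _ _ x≢y _ _ (proj₁ (joinOr-∈ b x≢y)) (proj₂ (joinOr-∈ b x≢y))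

  module Pencil {b₁ b₂ : Fin m} {Q : Point U} (Q∈b₁ : Q ∈ block b₁) (Q∉b₂ : Q ∉ block b₂) where

    ray : Point U → Subset (suc (n ^ 3))
    ray T = block (joinOr b₁ Q T) - Q - T

    ∈b₂⇒Q≢ : ∀ {T} → T ∈ block b₂ → Q ≢ T
    ∈b₂⇒Q≢ T∈b₂ refl = Q∉b₂ T∈b₂

    ∉b₁⇒≢Q : ∀ {P} → P ∉ block b₁ → P ≢ Q
    ∉b₁⇒≢Q P∉b₁ refl = P∉b₁ Q∈b₁

    ∣ray∣≤n∸1 : ∀ {T} → T ∈ block b₂ → ∣ ray T ∣ ≤ n ∸ 1
    ∣ray∣≤n∸1 T∈b₂ = let Q∈ , T∈ = joinOr-∈ b₁ (∈b₂⇒Q≢ T∈b₂) in ∣block-x-y∣≤n∸1 Q∈ T∈ (∈b₂⇒Q≢ T∈b₂)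

    full⇒∈ray : ∀ {P} → IsFull U b₁ b₂ P → ∃[ T ] T ∈ block b₂ × P ∈ ray T
    full⇒∈ray {P} (P∉b₁ , P∉b₂ , full)
      with c , P∈c , Q∈c ← join P Q (∉b₁⇒≢Q P∉b₁)
      with T , T∈c , T∈b₂ ← full Q Q∈b₁ c P∈c Q∈c
      = T , T∈b₂ , x∈p∧x≢y⇒x∈p-y (x∈p∧x≢y⇒x∈p-y P∈QT (∉b₁⇒≢Q P∉b₁)) λ { refl → P∉b₂ T∈b₂ }
      where
      P∈QT : P ∈ block (joinOr b₁ Q T)
      P∈QT = subst (λ d → P ∈ block d) (sym (joinOr-unique b₁ (∈b₂⇒Q≢ T∈b₂) Q∈c T∈c)) P∈c

    ∣FullSet∣≤∣p∣*[n∸1] : (p : Subset (suc (n ^ 3))) → p ⊆ block b₂ →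
                          (∀ {P} → IsFull U b₁ b₂ P → ∃[ T ] T ∈ p × P ∈ ray T) →
                          ∀ S → FullSet U b₁ b₂ S → ∣ S ∣ ≤ ∣ p ∣ * (n ∸ 1)
    ∣FullSet∣≤∣p∣*[n∸1] p p⊆b₂ onRay S S-full =
      ≤-trans (p⊆q⇒∣p∣≤∣q∣ S⊆⋃ray) (∣⋃∣≤∣p∣*k p ray (∣ray∣≤n∸1 ∘ p⊆b₂))
      where
      S⊆⋃ray : S ⊆ ⋃[ p ] ray
      S⊆⋃ray {P} P∈S = let T , T∈p , P∈ray = onRay (S-full P P∈S) in x∈⋃⁺ p ray T∈p P∈ray

  2≤∣block∣ : 2 ≤ n → ∀ b → 2 ≤ ∣ block b ∣
  2≤∣block∣ 2≤n b = ≤-trans 2≤n (≤-trans (m≤m+n n 1) (≤-reflexive (sym (blockSize b))))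

  Meet⇒∣FullSet∣≤n^2∸n : 2 ≤ n → ∀ {b₁ b₂} → b₁ ≢ b₂ → Meet U b₁ b₂ →
                         ∀ S → FullSet U b₁ b₂ S → ∣ S ∣ ≤ n ^ 2 ∸ n
  Meet⇒∣FullSet∣≤n^2∸n 2≤n {b₁} {b₂} b₁≢b₂ (R , R∈b₁ , R∈b₂) S S-full
    with Q , Q∈b₁ , Q≢R ← 2≤∣p∣⇒∃x∈p∧x≢y (block b₁) R (2≤∣block∣ 2≤n b₁) = begin
    ∣ S ∣                      ≤⟨ ∣FullSet∣≤∣p∣*[n∸1] (block b₂ - R) (p─q⊆p _ _) avoidsR S S-full ⟩
    ∣ block b₂ - R ∣ * (n ∸ 1) ≤⟨ *-monoˡ-≤ (n ∸ 1) ∣b₂-R∣≤n ⟩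
    n * (n ∸ 1)                ≡⟨ n*[n∸1]≡n^2∸n n ⟩
    n ^ 2 ∸ n                  ∎
    where
    open ≤-Reasoning
    Q∉b₂ : Q ∉ block b₂
    Q∉b₂ Q∈b₂ = b₁≢b₂ (joinUnique Q R Q≢R b₁ b₂ Q∈b₁ R∈b₁ Q∈b₂ R∈b₂)
    open Pencil Q∈b₁ Q∉b₂

    ∣b₂-R∣≤n : ∣ block b₂ - R ∣ ≤ n
    ∣b₂-R∣≤n = ≤-pred (≤-trans (x∈p⇒∣p-x∣<∣p∣ R∈b₂) (≤-reflexive (trans (blockSize b₂) (+-comm n 1))))

    avoidsR : ∀ {P} → IsFull U b₁ b₂ P → ∃[ T ] T ∈ block b₂ - R × P ∈ ray T
    avoidsR {P} P-full@(P∉b₁ , _) with T , T∈b₂ , P∈ray ← full⇒∈ray P-full =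
      T , x∈p∧x≢y⇒x∈p-y T∈b₂ T≢R , P∈ray
      where
      T≢R : T ≢ R
      T≢R refl = P∉b₁ (subst (λ d → P ∈ block d) (joinOr-unique b₁ Q≢R Q∈b₁ R∈b₁)
                                (p─q⊆p _ _ (p─q⊆p _ _ P∈ray)))

  ¬Meet⇒∣FullSet∣≤n^2∸1 : 2 ≤ n → ∀ {b₁ b₂} → ¬ Meet U b₁ b₂ →
                          ∀ S → FullSet U b₁ b₂ S → ∣ S ∣ ≤ n ^ 2 ∸ 1
  ¬Meet⇒∣FullSet∣≤n^2∸1 2≤n {b₁} {b₂} ¬meet S S-full
    with Q , Q∈b₁ , _ ← 2≤∣p∣⇒∃x∈p∧x≢y (block b₁) zero (2≤∣block∣ 2≤n b₁) = begin
    ∣ S ∣                  ≤⟨ ∣FullSet∣≤∣p∣*[n∸1] (block b₂) ⊆-refl full⇒∈ray S S-full ⟩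
    ∣ block b₂ ∣ * (n ∸ 1) ≡⟨ cong (_* (n ∸ 1)) (blockSize b₂) ⟩
    (n + 1) * (n ∸ 1)      ≡⟨ [n+1]*[n∸1]≡n^2∸1 n ⟩
    n ^ 2 ∸ 1              ∎
    where
    open ≤-Reasoning
    open Pencil Q∈b₁ (λ Q∈b₂ → ¬meet (Q , Q∈b₁ , Q∈b₂))

lemma2p1 : ∀ {n : ℕ} → 2 ≤ n → (U : AbstractUnital n) →
    ∀ (b₁ b₂ : Fin (AbstractUnital.m U)) → b₁ ≢ b₂ →
    (Meet U b₁ b₂ → ∀ S → FullSet U b₁ b₂ S → ∣ S ∣ ≤ n ^ 2 ∸ n) ×
    (¬ Meet U b₁ b₂ → ∀ S → FullSet U b₁ b₂ S → ∣ S ∣ ≤ n ^ 2 ∸ 1)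
lemma2p1 2≤n U b₁ b₂ b₁≢b₂ =
  Meet⇒∣FullSet∣≤n^2∸n U 2≤n b₁≢b₂ , ¬Meet⇒∣FullSet∣≤n^2∸1 U 2≤n
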